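{- Let $n\ge 3$ be odd, let $C_n$ be the cycle on $n$ nodes, and let $0<\alpha\le\frac12$. Then $\overleftarrow{MD}_{\alpha}(C_n)=1$.
   Context: A configuration is a map $\mathcal{C}:V\to\{b,w\}$ (black/white). In two-way $\alpha$-bootstrap percolation ($0<\alpha<1$), starting from $\mathcal{C}_0$, in each round $t\ge1$ all nodes update simultaneously: $\mathcal{C}_t(v)=b$ if the number of neighbors of $v$ that are black in $\mathcal{C}_{t-1}$ is at least $\alpha d(v)$ ($d(v)$ the degree of $v$), and $\mathcal{C}_t(v)=w$ otherwise. A set $D\subseteq V$ is a dynamo if for every initial configuration in which all nodes of $D$ are black, there is a round at which all nodes are black. $\overleftarrow{MD}_\alpha(G)$ denotes the minimum size of a dynamo in two-way $\alpha$-bootstrap percolation on $G$.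
   Formalization: The parameter α takes only rational values. -}

module Defs where

open import Data.Nat as ℕ using (ℕ; zero; suc; _≡ᵇ_; _%_; NonZero)
open import Data.Bool using (Bool; true; false; if_then_else_; _∨_)
open import Data.Fin using (Fin; toℕ)
open import Data.Fin.Subset using (Subset; _∈_; ∣_∣)
open import Data.List using (List; map)
open import Data.Nat.ListAction using (sum)
open import Data.List using () renaming (allFin to allFinL)
open import Data.Integer using (+_)
open import Data.Rational using (ℚ; _/_; _*_; _≤ᵇ_)
open import Data.Product using (Σ; ∃; _×_)
open import Relation.Binary.PropositionalEquality using (_≡_)

Graph : ℕ → Set
Graph n = Fin n → Fin n → Bool

cycle : (n : ℕ) → .{{_ : NonZero n}} → Graph n
cycle n i j = (toℕ j ≡ᵇ (suc (toℕ i) % n)) ∨ (toℕ i ≡ᵇ (suc (toℕ j) % n))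

data Colour : Set where
  b w : Colour

Configuration : ℕ → Set
Configuration n = Fin n → Colour

isBlack : Colour → Bool
isBlack b = true
isBlack w = false

countB : {n : ℕ} → (Fin n → Bool) → ℕ
countB {n} p = sum (map (λ u → if p u then 1 else 0) (allFinL n))

degree : {n : ℕ} → Graph n → Fin n → ℕ
degree G v = countB (G v)

blackNeighbours : {n : ℕ} → Graph n → Configuration n → Fin n → ℕ
blackNeighbours G C v = countB (λ u → G v u Data.Bool.∧ isBlack (C u))

-- One round of two-way α-bootstrap percolation:
-- v becomes black iff #black neighbours ≥ α · d(v).
step : {n : ℕ} → Graph n → ℚ → Configuration n → Configuration n
step G α C v =
  if (α * ((+ degree G v) / 1)) ≤ᵇ ((+ blackNeighbours G C v) / 1) then b else w

iterate : {n : ℕ} → Graph n → ℚ → ℕ → Configuration n → Configuration n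
iterate G α zero    C = C
iterate G α (suc t) C = step G α (iterate G α t C)

IsDynamo : {n : ℕ} → Graph n → ℚ → Subset n → Set
IsDynamo {n} G α D =
  (C₀ : Configuration n) → ((v : Fin n) → v ∈ D → C₀ v ≡ b) →
  ∃ λ t → (v : Fin n) → iterate G α t C₀ v ≡ b

MinDynamoSize : {n : ℕ} → Graph n → ℚ → ℕ → Set
MinDynamoSize {n} G α k =
  (Σ (Subset n) λ D → IsDynamo G α D × ∣ D ∣ ≡ k) ×
  ((D : Subset n) → IsDynamo G α D → k ℕ.≤ ∣ D ∣)

-- The empty set is no dynamo: every vertex of a cycle has a neighbour and α > 0, so
-- the all-white configuration is a fixed point. Conversely, every degree is at most 2
-- and α ≤ ½, so a single black neighbour turns a vertex black. With vertex 0 black,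
-- the vertex k mod n is therefore black at round k, and a black vertex is black again
-- two rounds later, its neighbour handing the colour back. So vertex v is black at the
-- rounds v and v + n; for odd n one of them is even, and all vertices are black at
-- round 2(n − 1).
module Submission where

open import Algebra.Properties.CommutativeSemigroup using (interchange)
open import Data.Bool using (Bool; true; false; if_then_else_; _∨_; _∧_; T)
open import Data.Bool.Properties using (T-∨; T-∧)
open import Data.Empty using (⊥-elim)
open import Data.Fin as Fin using (Fin; toℕ; fromℕ<)
import Data.Fin.Properties as FinP
open import Data.Fin.Subset using (Subset; _∈_; ∣_∣; ⁅_⁆)
open import Data.Fin.Subset.Properties using (∣⁅x⁆∣≡1; p⊆q⇒∣p∣≤∣q∣; x∈⁅y⁆⇒x≡y; x∈⁅x⁆)
open import Data.Integer as ℤ using (+_)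
import Data.Integer.Properties as ℤP
open import Data.List using (map; tabulate)
open import Data.List.Properties using (map-tabulate)
open import Data.Nat as ℕ using (ℕ; zero; suc; _+_; _*_; _≤_; _<_; z≤n; s≤s; _≡ᵇ_; _%_; NonZero)
open import Data.Nat.Coprimality as Coprime using (1-coprimeTo)
open import Data.Nat.DivMod using (%-distribˡ-+; m%n%n≡m%n; m%n<n; [m+n]%n≡m%n; m<n⇒m%n≡m)
open import Data.Nat.Divisibility using (_∣_; divides)
open import Data.Nat.ListAction using (sum)
import Data.Nat.Properties as ℕP
open import Data.Product using (∃; _,_; proj₂)
open import Data.Rational using (ℚ; ½; 0ℚ; 1ℚ; mkℚ; _/_; _≤ᵇ_; *≤*; Positive; NonNegative; positive)
  renaming (_*_ to _*ℚ_; _<_ to _<ℚ_; _≤_ to _≤ℚ_)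
import Data.Rational.Properties as ℚP
open import Data.Sum using (_⊎_; inj₁; inj₂)
open import Function using (_∘_; id)
open import Function.Bundles using (Equivalence)
open import Relation.Binary.PropositionalEquality
open import Relation.Nullary using (¬_; yes; no; contradiction)

open import Defs

countB-suc : ∀ {n} (p : Fin (suc n) → Bool) →
             countB p ≡ (if p Fin.zero then 1 else 0) + countB (p ∘ Fin.suc)
countB-suc p = cong (λ xs → f Fin.zero + sum xs)
  (trans (map-tabulate Fin.suc f) (sym (map-tabulate id (f ∘ Fin.suc))))
  where
  f : Fin _ → ℕ
  f u = if p u then 1 else 0

countB-pos : ∀ {n} (p : Fin n → Bool) {u} → T (p u) → 0 < countB p
countB-pos p {Fin.zero} pu rewrite countB-suc p with p Fin.zero
... | true = s≤s z≤n
countB-pos p {Fin.suc u} pu rewrite countB-suc p =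
  ℕP.≤-trans (countB-pos (p ∘ Fin.suc) pu) (ℕP.m≤n+m _ _)

countB-≡0 : ∀ {n} (p : Fin n → Bool) → (∀ u → ¬ T (p u)) → countB p ≡ 0
countB-≡0 {zero}  p none = refl
countB-≡0 {suc n} p none rewrite countB-suc p with p Fin.zero | none Fin.zero
... | true  | ¬p₀ = ⊥-elim (¬p₀ _)
... | false | _   = countB-≡0 (p ∘ Fin.suc) (none ∘ Fin.suc)

countB-≤1 : ∀ {n} (p : Fin n → Bool) → (∀ {u v} → T (p u) → T (p v) → u ≡ v) → countB p ≤ 1
countB-≤1 {zero}  p unique = z≤n
countB-≤1 {suc n} p unique rewrite countB-suc p with p Fin.zero in p₀
... | true  = ℕP.≤-reflexive (cong suc (countB-≡0 (p ∘ Fin.suc)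
                λ u pu → FinP.0≢1+n (unique (subst T (sym p₀) _) pu)))
... | false = countB-≤1 (p ∘ Fin.suc) (λ pu pv → FinP.suc-injective (unique pu pv))

countB-∨ : ∀ {n} (p q : Fin n → Bool) → countB (λ u → p u ∨ q u) ≤ countB p + countB q
countB-∨ {zero}  p q = z≤n
countB-∨ {suc n} p q rewrite countB-suc (λ u → p u ∨ q u) | countB-suc p | countB-suc q =
  ℕP.≤-trans (ℕP.+-mono-≤ (indicator-∨ (p Fin.zero) (q Fin.zero)) (countB-∨ (p ∘ Fin.suc) (q ∘ Fin.suc)))
             (ℕP.≤-reflexive (interchange ℕP.+-commutativeSemigroup
               (if p Fin.zero then 1 else 0) (if q Fin.zero then 1 else 0) _ _))
  where
  indicator-∨ : ∀ x y → (if x ∨ y then 1 else 0) ≤ (if x then 1 else 0) + (if y then 1 else 0)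
  indicator-∨ true  y = s≤s z≤n
  indicator-∨ false y = ℕP.≤-refl

ℕ/1≡mkℚ : ∀ k → + k / 1 ≡ mkℚ (+ k) 0 (Coprime.sym (1-coprimeTo k))
ℕ/1≡mkℚ k = ℚP.normalize-coprime _

ℕ/1-mono-≤ : ∀ {m n} → m ≤ n → + m / 1 ≤ℚ + n / 1
ℕ/1-mono-≤ {m} {n} m≤n rewrite ℕ/1≡mkℚ m | ℕ/1≡mkℚ n =
  *≤* (ℤP.*-monoʳ-≤-nonNeg (+ 1) (ℤ.+≤+ m≤n))

step≡b : ∀ {n} {G : Graph n} {α C v} →
         α *ℚ (+ degree G v / 1) ≤ℚ + blackNeighbours G C v / 1 → step G α C v ≡ b
step≡b {G = G} {α} {C} {v} ≤
  with α *ℚ (+ degree G v / 1) ≤ᵇ + blackNeighbours G C v / 1 | ℚP.≤⇒≤ᵇ ≤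
... | true | _ = refl

step≡w : ∀ {n} {G : Graph n} {α C v} →
         ¬ α *ℚ (+ degree G v / 1) ≤ℚ + blackNeighbours G C v / 1 → step G α C v ≡ w
step≡w {G = G} {α} {C} {v} ≰
  with α *ℚ (+ degree G v / 1) ≤ᵇ + blackNeighbours G C v / 1
     | ℚP.≤ᵇ⇒≤ {α *ℚ (+ degree G v / 1)} {+ blackNeighbours G C v / 1}
... | true  | ≤ = contradiction (≤ _) ≰
... | false | _ = refl

∈⇒0<∣p∣ : ∀ {n} {p : Subset n} {x} → x ∈ p → 0 < ∣ p ∣
∈⇒0<∣p∣ {p = p} {x} x∈p = subst (_≤ ∣ p ∣) (∣⁅x⁆∣≡1 x)
  (p⊆q⇒∣p∣≤∣q∣ λ y∈⁅x⁆ → subst (_∈ p) (sym (x∈⁅y⁆⇒x≡y x y∈⁅x⁆)) x∈p)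

module _ {α : ℚ} (0<α : 0ℚ <ℚ α) where
  private instance
    α-positive : Positive α
    α-positive = positive 0<α
    α-nonNegative : NonNegative α
    α-nonNegative = ℚP.pos⇒nonNeg α

  α*d≤1 : ∀ {d} → α ≤ℚ ½ → d ≤ 2 → α *ℚ (+ d / 1) ≤ℚ 1ℚ
  α*d≤1 {d} α≤½ d≤2 = begin
    α *ℚ (+ d / 1) ≤⟨ ℚP.*-monoˡ-≤-nonNeg α (ℕ/1-mono-≤ d≤2) ⟩
    α *ℚ (+ 2 / 1) ≤⟨ ℚP.*-monoʳ-≤-nonNeg (+ 2 / 1) α≤½ ⟩
    1ℚ             ∎
    where open ℚP.≤-Reasoning

  0<α*d : ∀ {d} → 0 < d → 0ℚ <ℚ α *ℚ (+ d / 1)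
  0<α*d {d} 0<d = begin-strict
    0ℚ             <⟨ 0<α ⟩
    α              ≡⟨ ℚP.*-identityʳ α ⟨
    α *ℚ 1ℚ        ≤⟨ ℚP.*-monoˡ-≤-nonNeg α (ℕ/1-mono-≤ 0<d) ⟩
    α *ℚ (+ d / 1) ∎
    where open ℚP.≤-Reasoning

  black-neighbour⇒step-black : ∀ {n} (G : Graph n) → (∀ v → degree G v ≤ 2) → α ≤ℚ ½ →
                               ∀ C {u v} → T (G u v) → C v ≡ b → step G α C u ≡ b
  black-neighbour⇒step-black G deg≤2 α≤½ C {u} {v} uv Cv≡b =
    step≡b {G = G} {α} {C} {u} (ℚP.≤-trans (α*d≤1 α≤½ (deg≤2 u)) (ℕ/1-mono-≤ 0<#black))
    where
    0<#black : 0 < blackNeighbours G C u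
    0<#black = countB-pos (λ x → G u x ∧ isBlack (C x))
      (Equivalence.from T-∧ (uv , subst (T ∘ isBlack) (sym Cv≡b) _))

  allWhite-stays-white : ∀ {n} (G : Graph n) → (∀ v → 0 < degree G v) →
                         ∀ t v → iterate G α t (λ _ → w) v ≡ w
  allWhite-stays-white G deg>0 zero    v = refl
  allWhite-stays-white G deg>0 (suc t) v = step≡w {G = G} {α} {C} {v} λ ≤ →
    ℚP.<-irrefl refl (ℚP.<-≤-trans (0<α*d (deg>0 v))
      (subst (α *ℚ (+ degree G v / 1) ≤ℚ_) (cong (λ k → + k / 1) #black≡0) ≤))
    where
    C = iterate G α t (λ _ → w)
    #black≡0 : blackNeighbours G C v ≡ 0
    #black≡0 = countB-≡0 _ λ u vu-black →
      subst (T ∘ isBlack) (allWhite-stays-white G deg>0 t u) (proj₂ (Equivalence.to T-∧ vu-black))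

  dynamo-nonempty : ∀ {n} (G : Graph (suc n)) → (∀ v → 0 < degree G v) →
                    ∀ D → IsDynamo G α D → 0 < ∣ D ∣
  dynamo-nonempty G deg>0 D dynamo with 0 ℕ.<? ∣ D ∣
  ... | yes 0<∣D∣ = 0<∣D∣
  ... | no  0≮∣D∣ =
    let t , all-black = dynamo (λ _ → w) (λ v v∈D → contradiction (∈⇒0<∣p∣ v∈D) 0≮∣D∣)
    in contradiction (trans (sym (all-black Fin.zero)) (allWhite-stays-white G deg>0 t Fin.zero)) λ ()

[m+n%d]%d≡[m+n]%d : ∀ m n d .{{_ : NonZero d}} → (m + n % d) % d ≡ (m + n) % d
[m+n%d]%d≡[m+n]%d m n d = begin
  (m + n % d) % d         ≡⟨ %-distribˡ-+ m (n % d) d ⟩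
  (m % d + n % d % d) % d ≡⟨ cong (λ r → (m % d + r) % d) (m%n%n≡m%n n d) ⟩
  (m % d + n % d) % d     ≡⟨ %-distribˡ-+ m n d ⟨
  (m + n) % d             ∎
  where open ≡-Reasoning

module Cycle (m : ℕ) where
  N : ℕ
  N = suc m

  next : Fin N → Fin N
  next v = fromℕ< (m%n<n (suc (toℕ v)) N)

  toℕ-next : ∀ v → toℕ (next v) ≡ suc (toℕ v) % N
  toℕ-next v = FinP.toℕ-fromℕ< _

  adjacent-next : ∀ v → T (cycle N v (next v))
  adjacent-next v = Equivalence.from T-∨ (inj₁ (ℕP.≡⇒≡ᵇ _ _ (toℕ-next v)))

  next-adjacent : ∀ v → T (cycle N (next v) v)
  next-adjacent v = Equivalence.from T-∨ (inj₂ (ℕP.≡⇒≡ᵇ _ _ (toℕ-next v)))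

  [m+[1+x]%N]%N≡x : ∀ {x} → x < N → (m + suc x % N) % N ≡ x
  [m+[1+x]%N]%N≡x {x} x<N = begin
    (m + suc x % N) % N ≡⟨ [m+n%d]%d≡[m+n]%d m (suc x) N ⟩
    (m + suc x) % N     ≡⟨ cong (_% N) (trans (ℕP.+-suc m x) (ℕP.+-comm N x)) ⟩
    (x + N) % N         ≡⟨ [m+n]%n≡m%n x N ⟩
    x % N               ≡⟨ m<n⇒m%n≡m x<N ⟩
    x                   ∎
    where open ≡-Reasoning

  [1+x]%N-injective : ∀ {x y} → x < N → y < N → suc x % N ≡ suc y % N → x ≡ y
  [1+x]%N-injective {x} {y} x<N y<N eq = begin
    x                   ≡⟨ [m+[1+x]%N]%N≡x x<N ⟨
    (m + suc x % N) % N ≡⟨ cong (λ r → (m + r) % N) eq ⟩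
    (m + suc y % N) % N ≡⟨ [m+[1+x]%N]%N≡x y<N ⟩
    y                   ∎
    where open ≡-Reasoning

  degree≤2 : ∀ v → degree (cycle N) v ≤ 2
  degree≤2 v = ℕP.≤-trans (countB-∨ is-next is-previous)
    (ℕP.+-mono-≤ (countB-≤1 is-next next-unique) (countB-≤1 is-previous previous-unique))
    where
    is-next is-previous : Fin N → Bool
    is-next u = toℕ u ≡ᵇ suc (toℕ v) % N
    is-previous u = toℕ v ≡ᵇ suc (toℕ u) % N
    next-unique : ∀ {u u′} → T (is-next u) → T (is-next u′) → u ≡ u′
    next-unique p p′ = FinP.toℕ-injective (trans (ℕP.≡ᵇ⇒≡ _ _ p) (sym (ℕP.≡ᵇ⇒≡ _ _ p′)))
    previous-unique : ∀ {u u′} → T (is-previous u) → T (is-previous u′) → u ≡ u′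
    previous-unique {u} {u′} p p′ = FinP.toℕ-injective
      ([1+x]%N-injective (FinP.toℕ<n u) (FinP.toℕ<n u′)
        (trans (sym (ℕP.≡ᵇ⇒≡ (toℕ v) _ p)) (ℕP.≡ᵇ⇒≡ (toℕ v) _ p′)))

  degree>0 : ∀ v → 0 < degree (cycle N) v
  degree>0 v = countB-pos (cycle N v) (adjacent-next v)

  module Spreading {α : ℚ} (0<α : 0ℚ <ℚ α) (α≤½ : α ≤ℚ ½) (C₀ : Configuration N) where
    Black : ℕ → Fin N → Set
    Black t v = iterate (cycle N) α t C₀ v ≡ b

    -- The rounds are passed explicitly: inferring them forces Agda to unfold `step`.
    black-neighbour : ∀ {t u v} → T (cycle N u v) → Black t v → Black (suc t) u
    black-neighbour {t} uv =
      black-neighbour⇒step-black 0<α (cycle N) degree≤2 α≤½ (iterate (cycle N) α t C₀) uv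

    black-recurs : ∀ {t v} → Black t v → Black (suc (suc t)) v
    black-recurs {t} {v} = black-neighbour {suc t} (adjacent-next v) ∘ black-neighbour {t} (next-adjacent v)

    black-persists : ∀ {i j v} → i ℕ.≤′ j → Black (i * 2) v → Black (j * 2) v
    black-persists ℕ.≤′-refl                     = id
    black-persists {j = suc j} (ℕ.≤′-step i≤′j) = black-recurs {j * 2} ∘ black-persists i≤′j

    module _ (C₀-0 : C₀ Fin.zero ≡ b) where
      black-at-distance : ∀ k v → toℕ v ≡ k % N → Black k v
      black-at-distance zero    v v≡0 =
        subst (Black 0) (FinP.toℕ-injective {i = Fin.zero} (sym v≡0)) C₀-0
      black-at-distance (suc k) v v≡k+1 = subst (Black (suc k)) (FinP.toℕ-injective next-u≡v)
          (black-neighbour {k} (next-adjacent u) (black-at-distance k u (FinP.toℕ-fromℕ< _)))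
        where
        u = fromℕ< (m%n<n k N)
        next-u≡v : toℕ (next u) ≡ toℕ v
        next-u≡v = begin
          toℕ (next u)    ≡⟨ toℕ-next u ⟩
          suc (toℕ u) % N ≡⟨ cong (λ r → suc r % N) (FinP.toℕ-fromℕ< _) ⟩
          (1 + k % N) % N ≡⟨ [m+n%d]%d≡[m+n]%d 1 k N ⟩
          suc k % N       ≡⟨ v≡k+1 ⟨
          toℕ v           ∎
          where open ≡-Reasoning

      black-at-own-index : ∀ v → Black (toℕ v) v
      black-at-own-index v = black-at-distance (toℕ v) v (sym (m<n⇒m%n≡m (FinP.toℕ<n v)))

      black-one-lap-later : ∀ v → Black (toℕ v + N) v
      black-one-lap-later v = black-at-distance (toℕ v + N) v
        (sym (trans ([m+n]%n≡m%n (toℕ v) N) (m<n⇒m%n≡m (FinP.toℕ<n v))))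

even-or-odd : ∀ k → ∃ λ i → k ≡ i * 2 ⊎ k ≡ suc (i * 2)
even-or-odd zero = 0 , inj₁ refl
even-or-odd (suc k) with even-or-odd k
... | i , inj₁ k≡2i   = i , inj₂ (cong suc k≡2i)
... | i , inj₂ k≡2i+1 = suc i , inj₁ (cong suc k≡2i+1)

odd⇒pred-even : ∀ m → ¬ 2 ∣ suc m → ∃ λ c → m ≡ c * 2
odd⇒pred-even m 2∤1+m with even-or-odd m
... | c , inj₁ m≡2c   = c , m≡2c
... | c , inj₂ m≡2c+1 = contradiction (divides (suc c) (cong suc m≡2c+1)) 2∤1+m

oddCycle-dynamo : ∀ c {α} → 0ℚ <ℚ α → α ≤ℚ ½ → IsDynamo (cycle (suc (c * 2))) α ⁅ Fin.zero ⁆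
oddCycle-dynamo c 0<α α≤½ C₀ ⁅0⁆-black = c * 2 * 2 , all-black
  where
  open Cycle (c * 2)
  open Spreading 0<α α≤½ C₀

  C₀-0 : C₀ Fin.zero ≡ b
  C₀-0 = ⁅0⁆-black Fin.zero (x∈⁅x⁆ Fin.zero)

  all-black : ∀ v → Black (c * 2 * 2) v
  all-black v with even-or-odd (toℕ v) | FinP.toℕ<n v
  ... | i , inj₁ v≡2i | v<N =
    black-persists (ℕP.≤⇒≤′ i≤2c) (subst (λ t → Black t v) v≡2i (black-at-own-index C₀-0 v))
    where
    i≤2c : i ≤ c * 2
    i≤2c = ℕP.≤-trans (ℕP.m≤m*n i 2) (ℕP.≤-pred (subst (_< N) v≡2i v<N))
  ... | i , inj₂ v≡2i+1 | v<N =
    black-persists (ℕP.≤⇒≤′ 1+i+c≤2c) (subst (λ t → Black t v) lap (black-one-lap-later C₀-0 v))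
    where
    i<c : i < c
    i<c = ℕP.*-cancelʳ-< 2 i c (ℕP.≤-pred (subst (_< N) v≡2i+1 v<N))
    1+i+c≤2c : suc (i + c) ≤ c * 2
    1+i+c≤2c = subst (suc (i + c) ≤_)
      (trans (cong (λ r → c + r) (sym (ℕP.+-identityʳ c))) (ℕP.*-comm 2 c)) (ℕP.+-monoˡ-≤ c i<c)
    lap : toℕ v + N ≡ suc (i + c) * 2
    lap = begin
      toℕ v + N                 ≡⟨ cong (_+ N) v≡2i+1 ⟩
      suc (i * 2) + N           ≡⟨ cong suc (ℕP.+-suc (i * 2) (c * 2)) ⟩
      suc (suc (i * 2 + c * 2)) ≡⟨ cong (suc ∘ suc) (ℕP.*-distribʳ-+ 2 i c) ⟨
      suc (i + c) * 2           ∎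
      where open ≡-Reasoning

mainTheorem4 : (n : ℕ) → .{{_ : NonZero n}} → 3 ≤ n → ¬ (2 ∣ n) →
    (α : ℚ) → 0ℚ <ℚ α → α ≤ℚ ½ →
    MinDynamoSize (cycle n) α 1
mainTheorem4 (suc m) _ n-odd α 0<α α≤½ with odd⇒pred-even m n-odd
... | c , refl = (⁅ Fin.zero ⁆ , oddCycle-dynamo c 0<α α≤½ , ∣⁅x⁆∣≡1 {suc (c * 2)} Fin.zero)
               , dynamo-nonempty 0<α (cycle (suc (c * 2))) (Cycle.degree>0 (c * 2))
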